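{- Let $g$ be an integer with $g\ge 4$. The number $N_2(g)$ of numerical semigroups with multiplicity four, genus $g$ and Frobenius number congruent to $2$ modulo $4$ is: - $1$, if $g=4$; - $1$, if $g=5$; - $(7-g)\left\lfloor\frac{2g+1}{5}\right\rfloor-\frac{g^2}{4}+\frac{25g}{4}-\frac{59}{2}$, if $6\le g\le 7$; - $-\left\lfloor\frac g5\right\rfloor^2+\left\lfloor\frac g4\right\rfloor^2-\frac32\left\lfloor\frac g3\right\rfloor^2+\left\lfloor\frac{2g}{5}\right\rfloor^2-\left\lfloor\frac{g+2}{5}\right\rfloor^2+\left\lfloor\frac{g+2}{4}\right\rfloor^2+\left\lfloor\frac{2g+1}{5}\right\rfloor^2-\left\lfloor\frac g5\right\rfloor+\left(g-\frac32\right)\left\lfloor\frac g3\right\rfloor+(1-g)\left\lfloor\frac{2g}{5}\right\rfloor+\left\lfloor\frac g4\right\rfloor\left(1-\left\lfloor\frac g2\right\rfloor\right)+\left(\frac g2-\frac14\right)\left\lfloor\frac g2\right\rfloor+\left\lfloor\frac{2g}{5}\right\rfloor\left\lfloor\frac{g+2}{5}\right\rfloor-\left\lfloor\frac g2\right\rfloor\left\lfloor\frac{g+2}{4}\right\rfloor+\left(\left\lfloor\frac g5\right\rfloor-g+1\right)\left\lfloor\frac{2g+1}{5}\right\rfloor+\frac{g^2}{8}-\frac g8$, if $g\ge 8$.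
   Context: A numerical semigroup is a submonoid $S$ of $(\mathbb{N},+)$ with $\mathbb{N}\setminus S$ finite. Its multiplicity is its least positive element, its genus is $\#(\mathbb{N}\setminus S)$ and its Frobenius number is $\max(\mathbb{N}\setminus S)$. $\lfloor\cdot\rfloor$ is the floor function. -}

module Defs where

open import Data.Nat using (ℕ; zero; suc; _+_; _*_; _≤_; _<_; _/_; _%_)
open import Data.Bool using (Bool; true; false; not)
open import Data.List using (List; upTo; filter; length)
open import Data.Fin using (Fin)
open import Data.Product using (Σ; ∃; _×_)
open import Data.Integer using (+_)
open import Data.Rational using (ℚ; _-_; -_) renaming (_+_ to _+q_; _*_ to _*q_; _/_ to _÷_)
open import Relation.Binary.PropositionalEquality using (_≡_; _≢_; _≗_)
open import Relation.Nullary using (¬_)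
open import Data.Bool.Properties using (T?)

-- A subset of ℕ is represented by its (decidable) characteristic function.
-- Every numerical semigroup is cofinite, hence decidable, so nothing is lost.
Subset : Set
Subset = ℕ → Bool

IsNumericalSemigroup : Subset → Set
IsNumericalSemigroup S =
  (S 0 ≡ true)
  × (∀ a b → S a ≡ true → S b ≡ true → S (a + b) ≡ true)
  × (∃ λ B → ∀ n → B ≤ n → S n ≡ true)

HasMultiplicity : Subset → ℕ → Set
HasMultiplicity S m = (0 < m) × (S m ≡ true) × (∀ k → 0 < k → k < m → S k ≡ false)

gapsBelow : Subset → ℕ → ℕ
gapsBelow S B = length (filter (λ n → T? (not (S n))) (upTo B))

HasGenus : Subset → ℕ → Set
HasGenus S g = ∃ λ B → (∀ n → B ≤ n → S n ≡ true) × (gapsBelow S B ≡ g)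

IsFrobenius : Subset → ℕ → Set
IsFrobenius S F = (S F ≡ false) × (∀ n → F < n → S n ≡ true)

N2Class : ℕ → Subset → Set
N2Class g S =
  IsNumericalSemigroup S × HasMultiplicity S 4 × HasGenus S g
  × (∃ λ F → IsFrobenius S F × (F % 4 ≡ 2))

HasExactly : ℕ → (Subset → Set) → Set
HasExactly n P =
  Σ (Fin n → Subset) λ L →
    (∀ i → P (L i))
    × (∀ i j → i ≢ j → ¬ (L i ≗ L j))
    × (∀ S → P S → ∃ λ i → S ≗ L i)

ℕq : ℕ → ℚ
ℕq n = + n ÷ 1

fr : ℕ → ℕ → ℚ   -- fr a b = a/b (b ≠ 0 needed; used only with literals)
fr a zero = ℕq 0
fr a (suc b) = + a ÷ suc b

E67 : ℕ → ℚ
E67 g = ((ℕq 7 - ℕq g) *q ℕq ((2 * g + 1) / 5)) - (fr 1 4 *q (ℕq g *q ℕq g))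
        +q (fr 25 4 *q ℕq g) - fr 59 2

E8 : ℕ → ℚ
E8 g =
  let a = ℕq (g / 5); b = ℕq (g / 4); c = ℕq (g / 3); d = ℕq ((2 * g) / 5)
      e = ℕq ((g + 2) / 5); f = ℕq ((g + 2) / 4); h = ℕq ((2 * g + 1) / 5)
      k = ℕq (g / 2); G = ℕq g
  in (- (a *q a)) +q (b *q b) - (fr 3 2 *q (c *q c)) +q (d *q d) - (e *q e)
     +q (f *q f) +q (h *q h) - a +q ((G - fr 3 2) *q c) +q ((ℕq 1 - G) *q d)
     +q (b *q (ℕq 1 - k)) +q ((fr 1 2 *q G - fr 1 4) *q k) +q (d *q e)
     - (k *q f) +q ((a - G +q ℕq 1) *q h) +q (fr 1 8 *q (G *q G)) - (fr 1 8 *q G)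

-- the paper's value of N₂(g) for g ≥ 4 (clauses for g < 4 are irrelevant)
N2value : ℕ → ℚ
N2value 4 = ℕq 1
N2value 5 = ℕq 1
N2value 6 = E67 6
N2value 7 = E67 7
N2value g = E8 g

module Submission where

-- A numerical semigroup S of multiplicity 4 is determined by its Kunz
-- coordinates k₁, k₂, k₃: the least element of S congruent to r modulo 4
-- is r + 4kᵣ, and S has genus k₁ + k₂ + k₃.  Its Frobenius number is
-- ≡ 2 (mod 4) exactly when k₁ ≤ k₂ and k₃ < k₂; under these conditions S is
-- closed under addition iff k₂ ≤ 2k₁ and k₂ ≤ 2k₃ + 1.  Substituting
-- k₃ = c + d, k₂ = c + 2d + 1, k₁ = g − (2c + 3d + 1), the semigroups
-- counted by N₂(g) are in bijection with the lattice points (d , c) with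
-- 3c + 5d + 3 > g and 5c + 8d + 3 ≤ 2g (sections 2 and 3).
--
-- Writing T_{a,b}(n) = #{(d , c) : ad + bc ≤ n}, the number C(g) of these
-- points satisfies C(3 + h) + T_{5,3}(h) = T_{8,5}(3 + 2h).  Each T_{a,b}
-- has constant second differences along any multiple of ab, so
-- C(g + 120) + C(g) = 2C(g + 60) + 120 (sections 4 and 5).  The paper's
-- closed form obeys the same recurrence, a polynomial identity in its
-- floors checked by the ring solver; hence both agree for every g ≥ 8 once
-- they agree for 8 ≤ g < 128, which is checked by evaluation, as are the
-- cases g = 4, …, 7 (section 6).

open import Defs
open import Data.Bool using (Bool; true; false; not; _∧_; T)
open import Data.Bool.Properties using (T?; T-≡)
open import Function.Bundles using (Equivalence)
open import Data.Fin using (Fin; zero; suc)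
open import Data.Integer using () renaming (+_ to +ℤ_)
open import Data.List using (List; []; _∷_; length; lookup; filter; map; _++_; upTo; applyUpTo; cartesianProduct)
open import Data.List.Properties using (filter-++; length-++)
open import Data.List.Membership.Propositional using (_∈_)
open import Data.List.Membership.Propositional.Properties using (∈-lookup; ∈-filter⁺; ∈-filter⁻; ∈-cartesianProduct⁺; ∈-upTo⁺)
open import Data.List.Relation.Unary.All as All using (All)
open import Data.List.Relation.Unary.All.Properties using (all⁺)
open import Data.List.Relation.Unary.AllPairs using (_∷_)
open import Data.List.Relation.Unary.Any using (here; there)
open import Data.List.Relation.Unary.Unique.Propositional using (Unique)
import Data.List.Relation.Unary.Unique.Propositional.Properties as Unique
open import Data.Nat using (ℕ; zero; suc; _+_; _*_; _∸_; _≤_; _<_; z≤n; s≤s; _≤?_; _<?_; _≤ᵇ_; NonZero; >-nonZero⁻¹; _/_; _%_)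
open import Data.Nat.DivMod using (m≡m%n+[m/n]*n; m%n<n; [m+kn]%n≡m%n; m≤n⇒m%n≡m; m<n⇒m/n≡0; m*n/n≡m; m/n*n≤m; m<n*o⇒m/o<n; /-monoˡ-≤; +-distrib-/-∣ʳ)
open import Data.Nat.Divisibility using (n∣m*n)
open import Data.Nat.Induction using (<-rec)
open import Data.Nat.Properties
open import Data.Nat.Tactic.RingSolver using (solve-∀)
open import Data.Product using (Σ; ∃; _×_; _,_; proj₁; proj₂)
open import Data.Sum using (inj₁; inj₂)
open import Data.Rational using (ℚ; mkℚ; _-_; -_) renaming (_+_ to _+q_; _*_ to _*q_; _≟_ to _≟q_)
open import Data.Rational.Properties using (normalize-coprime; +-0-group)
open import Algebra.Properties.Group +-0-group using () renaming (∙-cancelʳ to +q-cancelʳ)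
import Data.Rational.Solver as ℚSolver
open import Data.Nat.Coprimality using (1-coprimeTo) renaming (sym to coprime-sym)
open import Data.Integer.Properties using (+◃n≡+n)
open import Data.Unit using (tt)
open import Relation.Nullary using (¬_; yes; no; contradiction)
open import Relation.Nullary.Decidable using (isYes; toWitness)
open import Relation.Binary.PropositionalEquality

-- Section 1.  Finite sums and counting.

sumTo : (ℕ → ℕ) → ℕ → ℕ
sumTo f zero = 0
sumTo f (suc n) = f 0 + sumTo (λ x → f (suc x)) n

sumTo-split : ∀ f a K → sumTo f (a + K) ≡ sumTo f a + sumTo (λ x → f (a + x)) K
sumTo-split f zero K = refl
sumTo-split f (suc a) K =
  trans (cong (f 0 +_) (sumTo-split (λ x → f (suc x)) a K)) (sym (+-assoc (f 0) _ _))

sumTo-cong : ∀ f h K → (∀ x → x < K → f x ≡ h x) → sumTo f K ≡ sumTo h K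
sumTo-cong f h zero eq = refl
sumTo-cong f h (suc K) eq =
  cong₂ _+_ (eq 0 (s≤s z≤n)) (sumTo-cong (λ x → f (suc x)) (λ x → h (suc x)) K (λ x x<K → eq (suc x) (s≤s x<K)))

sumTo-+ : ∀ f h K → sumTo (λ x → f x + h x) K ≡ sumTo f K + sumTo h K
sumTo-+ f h zero = refl
sumTo-+ f h (suc K) rewrite sumTo-+ (λ x → f (suc x)) (λ x → h (suc x)) K =
  interchange (f 0) (h 0) (sumTo (λ x → f (suc x)) K) (sumTo (λ x → h (suc x)) K)
  where
  interchange : ∀ a b c d → a + b + (c + d) ≡ a + c + (b + d)
  interchange = solve-∀

sumTo-const : ∀ c K → sumTo (λ _ → c) K ≡ K * c
sumTo-const c zero = refl
sumTo-const c (suc K) = cong (c +_) (sumTo-const c K)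

sumTo-offset : ∀ f h c K → (∀ x → x < K → f x ≡ c + h x) → sumTo f K ≡ K * c + sumTo h K
sumTo-offset f h c K eq = begin
  sumTo f K                      ≡⟨ sumTo-cong f (λ x → c + h x) K eq ⟩
  sumTo (λ x → c + h x) K        ≡⟨ sumTo-+ (λ _ → c) h K ⟩
  sumTo (λ _ → c) K + sumTo h K  ≡⟨ cong (_+ sumTo h K) (sumTo-const c K) ⟩
  K * c + sumTo h K              ∎
  where open ≡-Reasoning

sumTo-vanishingTail : ∀ f b K → (∀ d → b ≤ d → f d ≡ 0) → b ≤ K → sumTo f K ≡ sumTo f b
sumTo-vanishingTail f b K vanish b≤K = begin
  sumTo f K                                     ≡⟨ cong (sumTo f) (sym (m+[n∸m]≡n b≤K)) ⟩
  sumTo f (b + (K ∸ b))                         ≡⟨ sumTo-split f b (K ∸ b) ⟩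
  sumTo f b + sumTo (λ x → f (b + x)) (K ∸ b)   ≡⟨ cong (sumTo f b +_) tail≡0 ⟩
  sumTo f b + 0                                 ≡⟨ +-identityʳ _ ⟩
  sumTo f b                                     ∎
  where
  open ≡-Reasoning
  tail≡0 : sumTo (λ x → f (b + x)) (K ∸ b) ≡ 0
  tail≡0 = trans (sumTo-cong _ (λ _ → 0) (K ∸ b) (λ x _ → vanish (b + x) (m≤m+n b x)))
                 (trans (sumTo-const 0 (K ∸ b)) (*-zeroʳ (K ∸ b)))

bit : Bool → ℕ
bit true = 1
bit false = 0

count-initialSegment : ∀ (p : ℕ → Bool) s K → s ≤ K → (∀ x → x < s → p x ≡ true)
  → (∀ x → s ≤ x → p x ≡ false) → sumTo (λ x → bit (p x)) K ≡ s
count-initialSegment p s K s≤K below above = begin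
  sumTo (λ x → bit (p x)) K ≡⟨ sumTo-vanishingTail _ s K (λ d s≤d → cong bit (above d s≤d)) s≤K ⟩
  sumTo (λ x → bit (p x)) s ≡⟨ sumTo-cong _ (λ _ → 1) s (λ x x<s → cong bit (below x x<s)) ⟩
  sumTo (λ _ → 1) s         ≡⟨ sumTo-const 1 s ⟩
  s * 1                     ≡⟨ *-identityʳ s ⟩
  s                         ∎
  where open ≡-Reasoning

length-filter-applyUpTo : ∀ (p : ℕ → Bool) h n →
  length (filter (λ x → T? (p x)) (applyUpTo h n)) ≡ sumTo (λ x → bit (p (h x))) n
length-filter-applyUpTo p h zero = refl
length-filter-applyUpTo p h (suc n) with p (h 0)
... | true = cong suc (length-filter-applyUpTo p (λ x → h (suc x)) n)
... | false = length-filter-applyUpTo p (λ x → h (suc x)) n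

length-filter-map : ∀ (p : ℕ × ℕ → Bool) x ys →
  length (filter (λ q → T? (p q)) (map (x ,_) ys)) ≡ length (filter (λ y → T? (p (x , y))) ys)
length-filter-map p x [] = refl
length-filter-map p x (y ∷ ys) with p (x , y)
... | true = cong suc (length-filter-map p x ys)
... | false = length-filter-map p x ys

length-filter-cartesianProduct : ∀ (p : ℕ × ℕ → Bool) h n ys →
  length (filter (λ q → T? (p q)) (cartesianProduct (applyUpTo h n) ys))
  ≡ sumTo (λ i → length (filter (λ y → T? (p (h i , y))) ys)) n
length-filter-cartesianProduct p h zero ys = refl
length-filter-cartesianProduct p h (suc n) ys = begin
  length (filter P? (map (h 0 ,_) ys ++ rest))
    ≡⟨ cong length (filter-++ P? (map (h 0 ,_) ys) rest) ⟩
  length (filter P? (map (h 0 ,_) ys) ++ filter P? rest)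
    ≡⟨ length-++ (filter P? (map (h 0 ,_) ys)) ⟩
  length (filter P? (map (h 0 ,_) ys)) + length (filter P? rest)
    ≡⟨ cong₂ _+_ (length-filter-map p (h 0) ys) (length-filter-cartesianProduct p (λ x → h (suc x)) n ys) ⟩
  sumTo (λ i → length (filter (λ y → T? (p (h i , y))) ys)) (suc n) ∎
  where
  open ≡-Reasoning
  P? = λ q → T? (p q)
  rest = cartesianProduct (applyUpTo (λ x → h (suc x)) n) ys

length-filter-square : ∀ (p : ℕ × ℕ → Bool) n →
  length (filter (λ q → T? (p q)) (cartesianProduct (upTo n) (upTo n)))
  ≡ sumTo (λ d → sumTo (λ c → bit (p (d , c))) n) n
length-filter-square p n = trans (length-filter-cartesianProduct p (λ x → x) n (upTo n))
  (sumTo-cong _ _ n (λ d _ → length-filter-applyUpTo (λ c → p (d , c)) (λ x → x) n))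

≤ᵇ-true : ∀ {m n} → m ≤ n → (m ≤ᵇ n) ≡ true
≤ᵇ-true {m} {n} m≤n with m ≤ᵇ n | ≤⇒≤ᵇ m≤n
... | true | _ = refl

≤ᵇ-false : ∀ {m n} → n < m → (m ≤ᵇ n) ≡ false
≤ᵇ-false {m} {n} n<m with m ≤ᵇ n in eq
... | false = refl
... | true = contradiction (≤ᵇ⇒≤ m n (subst T (sym eq) tt)) (<⇒≱ n<m)

≤ᵇ-true⁻¹ : ∀ {m n} → (m ≤ᵇ n) ≡ true → m ≤ n
≤ᵇ-true⁻¹ {m} {n} eq = ≤ᵇ⇒≤ m n (subst T (sym eq) tt)

≤ᵇ-false⁻¹ : ∀ {m n} → (m ≤ᵇ n) ≡ false → n < m
≤ᵇ-false⁻¹ eq = ≰⇒> (λ m≤n → true≢false (trans (sym (≤ᵇ-true m≤n)) eq))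
  where
  true≢false : true ≢ false
  true≢false ()

-- Section 2.  Semigroups of multiplicity 4 and their Kunz coordinates.

divMod4 : ∀ n → n ≡ n % 4 + (n / 4) * 4
divMod4 n = m≡m%n+[m/n]*n n 4

divAdd : ∀ m k d .{{_ : NonZero d}} → (m + k * d) / d ≡ m / d + k
divAdd m k d = trans (+-distrib-/-∣ʳ m (n∣m*n k)) (cong (m / d +_) (m*n/n≡m k d))

residue-% : ∀ r q → r < 4 → (r + q * 4) % 4 ≡ r
residue-% r q r<4 = trans ([m+kn]%n≡m%n r q 4) (m≤n⇒m%n≡m (≤-pred r<4))

residue-/ : ∀ r q → r < 4 → (r + q * 4) / 4 ≡ q
residue-/ r q r<4 = trans (divAdd r q 4) (cong (_+ q) (m<n⇒m/n≡0 r<4))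

kunzCoord : ℕ → ℕ → ℕ → ℕ → ℕ
kunzCoord k1 k2 k3 zero = 0
kunzCoord k1 k2 k3 (suc zero) = k1
kunzCoord k1 k2 k3 (suc (suc zero)) = k2
kunzCoord k1 k2 k3 (suc (suc (suc _))) = k3

-- The set with Apéry set {0, 1 + 4k₁, 2 + 4k₂, 3 + 4k₃} with respect to 4:
-- r + 4q belongs to it iff kᵣ ≤ q.
kunzSet : ℕ → ℕ → ℕ → Subset
kunzSet k1 k2 k3 n = kunzCoord k1 k2 k3 (n % 4) ≤ᵇ n / 4

kunzSet-at : ∀ k1 k2 k3 r q → r < 4 → kunzSet k1 k2 k3 (r + q * 4) ≡ (kunzCoord k1 k2 k3 r ≤ᵇ q)
kunzSet-at k1 k2 k3 r q r<4 = cong₂ (λ a b → kunzCoord k1 k2 k3 a ≤ᵇ b) (residue-% r q r<4) (residue-/ r q r<4)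

kunzSet-coord-injective : ∀ {a1 a2 a3 b1 b2 b3} r → r < 4 → kunzSet a1 a2 a3 ≗ kunzSet b1 b2 b3
  → kunzCoord a1 a2 a3 r ≡ kunzCoord b1 b2 b3 r
kunzSet-coord-injective {a1} {a2} {a3} {b1} {b2} {b3} r r<4 eq =
  ≤-antisym (≤ᵇ-true⁻¹ (trans (at b) (≤ᵇ-true (≤-refl {b})))) (≤ᵇ-true⁻¹ (trans (sym (at a)) (≤ᵇ-true (≤-refl {a}))))
  where
  a = kunzCoord a1 a2 a3 r
  b = kunzCoord b1 b2 b3 r
  at : ∀ q → (a ≤ᵇ q) ≡ (b ≤ᵇ q)
  at q = trans (sym (kunzSet-at a1 a2 a3 r q r<4)) (trans (eq (r + q * 4)) (kunzSet-at b1 b2 b3 r q r<4))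

gapsBelow-sum : ∀ S B → gapsBelow S B ≡ sumTo (λ x → bit (not (S x))) B
gapsBelow-sum S B = length-filter-applyUpTo (λ x → not (S x)) (λ x → x) B

gapsBelow-ext : ∀ S S' → S ≗ S' → ∀ B → gapsBelow S B ≡ gapsBelow S' B
gapsBelow-ext S S' eq B = trans (gapsBelow-sum S B)
  (trans (sumTo-cong _ _ B (λ x _ → cong (λ b → bit (not b)) (eq x))) (sym (gapsBelow-sum S' B)))

gapsBelow-stable : ∀ S B → (∀ n → B ≤ n → S n ≡ true) → ∀ m → gapsBelow S (B + m) ≡ gapsBelow S B
gapsBelow-stable S B cofinite m = trans (gapsBelow-sum S (B + m)) (trans
  (sumTo-vanishingTail _ B (B + m) (λ d B≤d → cong (λ b → bit (not b)) (cofinite d B≤d)) (m≤m+n B m))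
  (sym (gapsBelow-sum S B)))

sumTo-blocks : ∀ f N → sumTo f (N * 4) ≡ sumTo (λ q → f (q * 4) + f (1 + q * 4) + f (2 + q * 4) + f (3 + q * 4)) N
sumTo-blocks f zero = refl
sumTo-blocks f (suc N) = trans (regroup (f 0) (f 1) (f 2) (f 3) _) (cong (f 0 + f 1 + f 2 + f 3 +_) (sumTo-blocks (λ x → f (4 + x)) N))
  where
  regroup : ∀ a b c d s → a + (b + (c + (d + s))) ≡ a + b + c + d + s
  regroup = solve-∀

-- The residue class r contributes the kᵣ gaps r, r + 4, …, r + 4(kᵣ − 1).
gapsBelow-kunzSet : ∀ k1 k2 k3 N → k1 ≤ N → k2 ≤ N → k3 ≤ N → gapsBelow (kunzSet k1 k2 k3) (N * 4) ≡ k1 + k2 + k3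
gapsBelow-kunzSet k1 k2 k3 N k1≤N k2≤N k3≤N = begin
  gapsBelow S (N * 4)                                ≡⟨ gapsBelow-sum S (N * 4) ⟩
  sumTo gap (N * 4)                                  ≡⟨ sumTo-blocks gap N ⟩
  sumTo (λ q → gap (q * 4) + gap (1 + q * 4) + gap (2 + q * 4) + gap (3 + q * 4)) N
                                                     ≡⟨ sumTo-cong _ _ N (λ q _ → block q) ⟩
  sumTo (λ q → below k1 q + below k2 q + below k3 q) N
                                                     ≡⟨ sumTo-+ (λ q → below k1 q + below k2 q) (below k3) N ⟩
  sumTo (λ q → below k1 q + below k2 q) N + sumTo (below k3) N
                                                     ≡⟨ cong (_+ sumTo (below k3) N) (sumTo-+ (below k1) (below k2) N) ⟩
  sumTo (below k1) N + sumTo (below k2) N + sumTo (below k3) N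
                                                     ≡⟨ cong₂ _+_ (cong₂ _+_ (count k1 k1≤N) (count k2 k2≤N)) (count k3 k3≤N) ⟩
  k1 + k2 + k3                                       ∎
  where
  open ≡-Reasoning
  S = kunzSet k1 k2 k3
  gap = λ x → bit (not (S x))
  below = λ k q → bit (not (k ≤ᵇ q))
  count : ∀ k → k ≤ N → sumTo (below k) N ≡ k
  count k k≤N = count-initialSegment (λ q → not (k ≤ᵇ q)) k N k≤N
    (λ x x<k → cong not (≤ᵇ-false x<k)) (λ x k≤x → cong not (≤ᵇ-true k≤x))
  block : ∀ q → gap (q * 4) + gap (1 + q * 4) + gap (2 + q * 4) + gap (3 + q * 4)
              ≡ below k1 q + below k2 q + below k3 q
  block q rewrite kunzSet-at k1 k2 k3 0 q (s≤s z≤n) | kunzSet-at k1 k2 k3 1 q (s≤s (s≤s z≤n))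
                | kunzSet-at k1 k2 k3 2 q (s≤s (s≤s (s≤s z≤n))) | kunzSet-at k1 k2 k3 3 q (s≤s (s≤s (s≤s (s≤s z≤n)))) = refl

-- Kunz coordinates of a semigroup of multiplicity 4 and genus g whose Frobenius
-- number is ≡ 2 (mod 4).  The remaining Kunz inequalities k₃ ≤ k₁ + k₂ and
-- k₁ ≤ k₂ + k₃ + 1 follow from k₃ < k₂ and k₁ ≤ k₂.
record Kunz₂ (g k1 k2 k3 : ℕ) : Set where
  field
    k1≥1 : 1 ≤ k1
    k3≥1 : 1 ≤ k3
    k1≤k2 : k1 ≤ k2
    k2≤2k1 : k2 ≤ k1 + k1
    k3<k2 : k3 < k2
    k2≤2k3+1 : k2 ≤ suc (k3 + k3)
    genus : k1 + k2 + k3 ≡ g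

module KunzSetInClass {g k1 k2 k3 : ℕ} (kz : Kunz₂ g k1 k2 k3) where
  open Kunz₂ kz
  S = kunzSet k1 k2 k3
  K = kunzCoord k1 k2 k3

  1<4 : 1 < 4
  1<4 = s≤s (s≤s z≤n)
  2<4 : 2 < 4
  2<4 = s≤s (s≤s (s≤s z≤n))
  3<4 : 3 < 4
  3<4 = s≤s (s≤s (s≤s (s≤s z≤n)))

  member : ∀ r q → r < 4 → K r ≤ q → S (r + q * 4) ≡ true
  member r q r<4 Kr≤q = trans (kunzSet-at k1 k2 k3 r q r<4) (≤ᵇ-true Kr≤q)

  member-divMod : ∀ n → K (n % 4) ≤ n / 4 → S n ≡ true
  member-divMod n le = subst (λ m → S m ≡ true) (sym (divMod4 n)) (member (n % 4) (n / 4) (m%n<n n 4) le)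

  member-sum : ∀ ra rb r c qa qb → ra + rb ≡ r + c * 4 → r < 4 → K r ≤ K ra + K rb + c
    → K ra ≤ qa → K rb ≤ qb → S ((ra + qa * 4) + (rb + qb * 4)) ≡ true
  member-sum ra rb r c qa qb carry r<4 kunz la lb =
    subst (λ n → S n ≡ true) (sym rearrange) (member r (qa + qb + c) r<4 (≤-trans kunz (+-monoˡ-≤ c (+-mono-≤ la lb))))
    where
    open ≡-Reasoning
    rearrange : (ra + qa * 4) + (rb + qb * 4) ≡ r + (qa + qb + c) * 4
    rearrange = begin
      (ra + qa * 4) + (rb + qb * 4) ≡⟨ regroup₁ ra rb qa qb ⟩
      (ra + rb) + (qa + qb) * 4     ≡⟨ cong (_+ (qa + qb) * 4) carry ⟩
      r + c * 4 + (qa + qb) * 4     ≡⟨ regroup₂ r c qa qb ⟩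
      r + (qa + qb + c) * 4         ∎
      where
      regroup₁ : ∀ ra rb qa qb → (ra + qa * 4) + (rb + qb * 4) ≡ (ra + rb) + (qa + qb) * 4
      regroup₁ = solve-∀
      regroup₂ : ∀ r c qa qb → r + c * 4 + (qa + qb) * 4 ≡ r + (qa + qb + c) * 4
      regroup₂ = solve-∀

  ≤+0+0 : ∀ x → x ≤ x + 0 + 0
  ≤+0+0 x = ≤-reflexive (sym (trans (+-identityʳ (x + 0)) (+-identityʳ x)))

  closed-classes : ∀ ra rb → ra < 4 → rb < 4 → ∀ qa qb → K ra ≤ qa → K rb ≤ qb
    → S ((ra + qa * 4) + (rb + qb * 4)) ≡ true
  closed-classes zero rb _ rb<4 qa qb = member-sum 0 rb rb 0 qa qb (sym (+-identityʳ rb)) rb<4 (≤-reflexive (sym (+-identityʳ (K rb))))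
  closed-classes 1 0 _ _ qa qb = member-sum 1 0 1 0 qa qb refl 1<4 (≤+0+0 k1)
  closed-classes 1 1 _ _ qa qb = member-sum 1 1 2 0 qa qb refl 2<4 (≤-trans k2≤2k1 (m≤m+n _ 0))
  closed-classes 1 2 _ _ qa qb = member-sum 1 2 3 0 qa qb refl 3<4 (≤-trans (<⇒≤ k3<k2) (≤-trans (m≤n+m k2 k1) (m≤m+n _ 0)))
  closed-classes 1 3 _ _ qa qb = member-sum 1 3 0 1 qa qb refl (s≤s z≤n) z≤n
  closed-classes 2 0 _ _ qa qb = member-sum 2 0 2 0 qa qb refl 2<4 (≤+0+0 k2)
  closed-classes 2 1 _ _ qa qb = member-sum 2 1 3 0 qa qb refl 3<4 (≤-trans (<⇒≤ k3<k2) (≤-trans (m≤m+n k2 k1) (m≤m+n _ 0)))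
  closed-classes 2 2 _ _ qa qb = member-sum 2 2 0 1 qa qb refl (s≤s z≤n) z≤n
  closed-classes 2 3 _ _ qa qb = member-sum 2 3 1 1 qa qb refl 1<4 (≤-trans k1≤k2 (≤-trans (m≤m+n k2 k3) (m≤m+n _ 1)))
  closed-classes 3 0 _ _ qa qb = member-sum 3 0 3 0 qa qb refl 3<4 (≤+0+0 k3)
  closed-classes 3 1 _ _ qa qb = member-sum 3 1 0 1 qa qb refl (s≤s z≤n) z≤n
  closed-classes 3 2 _ _ qa qb = member-sum 3 2 1 1 qa qb refl 1<4 (≤-trans k1≤k2 (≤-trans (m≤n+m k2 k3) (m≤m+n _ 1)))
  closed-classes 3 3 _ _ qa qb = member-sum 3 3 2 1 qa qb refl 2<4 (≤-trans k2≤2k3+1 (≤-reflexive (+-comm 1 (k3 + k3))))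
  closed-classes (suc (suc (suc (suc _)))) _ (s≤s (s≤s (s≤s (s≤s ())))) _ _ _ _ _
  closed-classes (suc _) (suc (suc (suc (suc _)))) _ (s≤s (s≤s (s≤s (s≤s ())))) _ _ _ _

  closed : ∀ a b → S a ≡ true → S b ≡ true → S (a + b) ≡ true
  closed a b a∈S b∈S = subst (λ n → S n ≡ true) (sym (cong₂ _+_ (divMod4 a) (divMod4 b)))
    (closed-classes (a % 4) (b % 4) (m%n<n a 4) (m%n<n b 4) (a / 4) (b / 4) (≤ᵇ-true⁻¹ a∈S) (≤ᵇ-true⁻¹ b∈S))

  coord≤g : ∀ r → K r ≤ g
  coord≤g zero = z≤n
  coord≤g 1 = subst (k1 ≤_) genus (≤-trans (m≤m+n k1 k2) (m≤m+n _ k3))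
  coord≤g 2 = subst (k2 ≤_) genus (≤-trans (m≤n+m k2 k1) (m≤m+n _ k3))
  coord≤g (suc (suc (suc _))) = subst (k3 ≤_) genus (m≤n+m k3 (k1 + k2))

  cofinite : ∀ n → g * 4 ≤ n → S n ≡ true
  cofinite n 4g≤n = member-divMod n (≤-trans (coord≤g (n % 4)) g≤n/4)
    where
    g≤n/4 : g ≤ n / 4
    g≤n/4 = ≮⇒≥ (λ n/4<g → <⇒≱ (<-≤-trans (+-monoˡ-< (n / 4 * 4) (m%n<n n 4)) (*-monoˡ-≤ 4 n/4<g))
                                 (subst (g * 4 ≤_) (divMod4 n) 4g≤n))

  multiplicity : HasMultiplicity S 4
  multiplicity = s≤s z≤n , refl , below4
    where
    below4 : ∀ k → 0 < k → k < 4 → S k ≡ false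
    below4 1 _ _ = ≤ᵇ-false k1≥1
    below4 2 _ _ = ≤ᵇ-false (≤-trans k1≥1 k1≤k2)
    below4 3 _ _ = ≤ᵇ-false k3≥1
    below4 (suc (suc (suc (suc _)))) _ (s≤s (s≤s (s≤s (s≤s ()))))

  -- The Frobenius number is 2 + 4(k₂ − 1): every larger number lies in S.
  p = k2 ∸ 1
  suc-p : suc p ≡ k2
  suc-p = m+[n∸m]≡n (≤-trans k1≥1 k1≤k2)

  frobenius∉S : S (2 + p * 4) ≡ false
  frobenius∉S = trans (kunzSet-at k1 k2 k3 2 p 2<4) (≤ᵇ-false (subst (p <_) suc-p ≤-refl))

  above-frobenius : ∀ n → 2 + p * 4 < n → S n ≡ true
  above-frobenius n F<n = member-divMod n (above (n % 4) (n / 4) (m%n<n n 4) (subst (2 + p * 4 <_) (divMod4 n) F<n))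
    where
    quot-≤ : ∀ r r' q q' → r' < 4 → r + q * 4 < r' + q' * 4 → q ≤ q'
    quot-≤ r r' q q' r'<4 lt = ≮⇒≥ (λ q'<q → <-asym lt (<-≤-trans (+-monoˡ-< (q' * 4) r'<4) (≤-trans (*-monoˡ-≤ 4 q'<q) (m≤n+m (q * 4) r))))
    quot-< : ∀ r r' q q' → r' ≤ r → r + q * 4 < r' + q' * 4 → q < q'
    quot-< r r' q q' r'≤r lt = ≰⇒> (λ q'≤q → <⇒≱ lt (+-mono-≤ r'≤r (*-monoˡ-≤ 4 q'≤q)))
    above : ∀ r q → r < 4 → 2 + p * 4 < r + q * 4 → K r ≤ q
    above zero q _ _ = z≤n
    above 1 q _ lt = ≤-trans k1≤k2 (subst (_≤ q) suc-p (quot-< 2 1 p q (s≤s z≤n) lt))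
    above 2 q _ lt = subst (_≤ q) suc-p (quot-< 2 2 p q ≤-refl lt)
    above 3 q _ lt = ≤-trans (≤-pred (subst (k3 <_) (sym suc-p) k3<k2)) (quot-≤ 2 3 p q 3<4 lt)
    above (suc (suc (suc (suc _)))) q (s≤s (s≤s (s≤s (s≤s ())))) _

  inClass : N2Class g S
  inClass = (refl , closed , g * 4 , cofinite) , multiplicity
          , (g * 4 , cofinite , trans (gapsBelow-kunzSet k1 k2 k3 g (coord≤g 1) (coord≤g 2) (coord≤g 3)) genus)
          , (2 + p * 4 , (frobenius∉S , above-frobenius) , residue-% 2 p 2<4)

firstTrue : ∀ (p : ℕ → Bool) N → p N ≡ true → Σ ℕ λ k → p k ≡ true × (∀ j → j < k → p j ≡ false)
firstTrue p zero pN = 0 , pN , λ j ()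
firstTrue p (suc N) pN with p 0 in p0
... | true = 0 , p0 , λ j ()
... | false with firstTrue (λ x → p (suc x)) N pN
...   | k , pk , before = suc k , pk , λ { zero _ → p0 ; (suc j) (s≤s j<k) → before j j<k }

module KunzCoordinates (S : Subset) (0∈S : S 0 ≡ true)
    (closed : ∀ a b → S a ≡ true → S b ≡ true → S (a + b) ≡ true)
    (B : ℕ) (cofinite : ∀ n → B ≤ n → S n ≡ true) (4∈S : S 4 ≡ true) where

  multiples : ∀ q → S (q * 4) ≡ true
  multiples zero = 0∈S
  multiples (suc q) = closed 4 (q * 4) 4∈S (multiples q)

  least : ∀ r → Σ ℕ λ k → S (r + k * 4) ≡ true × (∀ j → j < k → S (r + j * 4) ≡ false)
  least r = firstTrue (λ q → S (r + q * 4)) B (cofinite (r + B * 4) (≤-trans (m≤m*n B 4) (m≤n+m (B * 4) r)))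

  k1 = proj₁ (least 1)
  k2 = proj₁ (least 2)
  k3 = proj₁ (least 3)

  residueClass : ∀ r k → S (r + k * 4) ≡ true → (∀ j → j < k → S (r + j * 4) ≡ false)
    → ∀ q → S (r + q * 4) ≡ (k ≤ᵇ q)
  residueClass r k rk∈S before q with k ≤? q
  ... | yes k≤q = trans (subst (λ n → S n ≡ true) shift (closed (r + k * 4) ((q ∸ k) * 4) rk∈S (multiples (q ∸ k))))
                        (sym (≤ᵇ-true k≤q))
    where
    distrib : ∀ r k t → r + k * 4 + t * 4 ≡ r + (k + t) * 4
    distrib = solve-∀
    shift : r + k * 4 + (q ∸ k) * 4 ≡ r + q * 4
    shift = trans (distrib r k (q ∸ k)) (cong (λ z → r + z * 4) (m+[n∸m]≡n k≤q))
  ... | no k≰q = trans (before q (≰⇒> k≰q)) (sym (≤ᵇ-false (≰⇒> k≰q)))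

  classOf : ∀ r q → S (r + q * 4) ≡ (proj₁ (least r) ≤ᵇ q)
  classOf r = residueClass r (proj₁ (least r)) (proj₁ (proj₂ (least r))) (proj₂ (proj₂ (least r)))

  kunzSet-equal : S ≗ kunzSet k1 k2 k3
  kunzSet-equal n = trans (cong S (divMod4 n)) (byResidue (n % 4) (n / 4) (m%n<n n 4))
    where
    byResidue : ∀ r q → r < 4 → S (r + q * 4) ≡ (kunzCoord k1 k2 k3 r ≤ᵇ q)
    byResidue zero q _ = multiples q
    byResidue 1 q _ = classOf 1 q
    byResidue 2 q _ = classOf 2 q
    byResidue 3 q _ = classOf 3 q
    byResidue (suc (suc (suc (suc _)))) q (s≤s (s≤s (s≤s (s≤s ()))))

  coord-positive : ∀ r → S r ≡ false → 1 ≤ proj₁ (least r)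
  coord-positive r r∉S with least r
  ... | zero , r∈S , _ = contradiction (trans (sym r∈S) (trans (cong S (+-identityʳ r)) r∉S)) (λ ())
  ... | suc _ , _ , _ = s≤s z≤n

  -- 2(1 + 4k₁) = 2 + 4·2k₁ ∈ S.
  k2≤2k1 : k2 ≤ k1 + k1
  k2≤2k1 = ≤ᵇ-true⁻¹ (trans (sym (classOf 2 (k1 + k1))) (subst (λ n → S n ≡ true) (double k1) (closed _ _ a∈S a∈S)))
    where
    a∈S = proj₁ (proj₂ (least 1))
    double : ∀ k → (1 + k * 4) + (1 + k * 4) ≡ 2 + (k + k) * 4
    double = solve-∀

  -- 2(3 + 4k₃) = 2 + 4(2k₃ + 1) ∈ S.
  k2≤2k3+1 : k2 ≤ suc (k3 + k3)
  k2≤2k3+1 = ≤ᵇ-true⁻¹ (trans (sym (classOf 2 (suc (k3 + k3)))) (subst (λ n → S n ≡ true) (double k3) (closed _ _ a∈S a∈S)))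
    where
    a∈S = proj₁ (proj₂ (least 3))
    double : ∀ k → (3 + k * 4) + (3 + k * 4) ≡ 2 + suc (k + k) * 4
    double = solve-∀

  genus-coords : ∀ B' → (∀ n → B' ≤ n → S n ≡ true) → gapsBelow S B' ≡ k1 + k2 + k3
  genus-coords B' cofinite' = begin
    gapsBelow S B'                           ≡⟨ sym (gapsBelow-stable S B' cofinite' (B' * 3 + K * 4)) ⟩
    gapsBelow S (B' + (B' * 3 + K * 4))      ≡⟨ cong (gapsBelow S) (regroup B' K) ⟩
    gapsBelow S ((B' + K) * 4)               ≡⟨ gapsBelow-ext S (kunzSet k1 k2 k3) kunzSet-equal ((B' + K) * 4) ⟩
    gapsBelow (kunzSet k1 k2 k3) ((B' + K) * 4)
      ≡⟨ gapsBelow-kunzSet k1 k2 k3 (B' + K) (≤N (≤-trans (m≤m+n k1 k2) (m≤m+n _ k3)))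
                                             (≤N (≤-trans (m≤n+m k2 k1) (m≤m+n _ k3))) (≤N (m≤n+m k3 (k1 + k2))) ⟩
    K                                        ∎
    where
    open ≡-Reasoning
    K = k1 + k2 + k3
    regroup : ∀ b k → b + (b * 3 + k * 4) ≡ (b + k) * 4
    regroup = solve-∀
    ≤N : ∀ {x} → x ≤ K → x ≤ B' + K
    ≤N x≤K = ≤-trans x≤K (m≤n+m K B')

  -- A Frobenius number F = 2 + 4q forces k₁ ≤ k₂ (as 1 + 4k₂ > F) and
  -- k₃ < k₂ (as 3 + 4(k₂ − 1) > F).
  module FrobeniusTwo (F : ℕ) (F∉S : S F ≡ false) (aboveF : ∀ n → F < n → S n ≡ true) (F%4 : F % 4 ≡ 2) where
    q = F / 4
    F≡ : F ≡ 2 + q * 4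
    F≡ = trans (divMod4 F) (cong (_+ q * 4) F%4)

    q<k2 : q < k2
    q<k2 = ≤ᵇ-false⁻¹ (trans (sym (classOf 2 q)) (subst (λ n → S n ≡ false) F≡ F∉S))

    k1≤k2 : k1 ≤ k2
    k1≤k2 = ≤ᵇ-true⁻¹ (trans (sym (classOf 1 k2)) (aboveF (1 + k2 * 4)
      (subst (_< 1 + k2 * 4) (sym F≡) (≤-trans (n≤1+n (3 + q * 4)) (≤-trans (*-monoˡ-≤ 4 q<k2) (n≤1+n _))))))

    k3<k2 : k3 < k2
    k3<k2 = subst (k3 <_) suc-p (s≤s (≤ᵇ-true⁻¹ (trans (sym (classOf 3 p)) (aboveF (3 + p * 4)
      (subst (_< 3 + p * 4) (sym F≡) (s≤s (+-monoʳ-≤ 2 (*-monoˡ-≤ 4 q≤p))))))))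
      where
      p = k2 ∸ 1
      suc-p : suc p ≡ k2
      suc-p = m+[n∸m]≡n (≤-trans (s≤s z≤n) q<k2)
      q≤p : q ≤ p
      q≤p = ≤-pred (subst (q <_) (sym suc-p) q<k2)

inClass⇒kunz : ∀ g S → N2Class g S → ∃ λ k1 → ∃ λ k2 → ∃ λ k3 → Kunz₂ g k1 k2 k3 × S ≗ kunzSet k1 k2 k3
inClass⇒kunz g S ((0∈S , closed , B , cofinite) , (_ , 4∈S , below4) , (B' , cofinite' , gapsB') , (F , (F∉S , aboveF) , F%4)) =
  k1 , k2 , k3 , kunz₂ , kunzSet-equal
  where
  open KunzCoordinates S 0∈S closed B cofinite 4∈S
  open FrobeniusTwo F F∉S aboveF F%4
  kunz₂ : Kunz₂ g k1 k2 k3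
  kunz₂ = record
    { k1≥1 = coord-positive 1 (below4 1 (s≤s z≤n) (s≤s (s≤s z≤n)))
    ; k3≥1 = coord-positive 3 (below4 3 (s≤s z≤n) (s≤s (s≤s (s≤s (s≤s z≤n)))))
    ; k1≤k2 = k1≤k2 ; k2≤2k1 = k2≤2k1 ; k3<k2 = k3<k2 ; k2≤2k3+1 = k2≤2k3+1
    ; genus = trans (sym (genus-coords B' cofinite')) gapsB' }

-- Section 3.  Kunz coordinates as lattice points.

-- The pair (d , c) stands for k₃ = c + d, k₂ = c + 2d + 1 and k₁ = g − (2c + 3d + 1);
-- then k₃ < k₂ ≤ 2k₃ + 1 hold automatically.
pairSet : ℕ → ℕ × ℕ → Subset
pairSet g (d , c) = kunzSet (g ∸ suc (2 * c + 3 * d)) (suc (c + 2 * d)) (c + d)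

-- 3c + 5d + 3 ≤ g, which is k₂ < k₁.
small : ℕ → ℕ × ℕ → Bool
small g (d , c) = 3 * c + 5 * d + 3 ≤ᵇ g

-- 5c + 8d + 3 ≤ 2g, which is k₂ ≤ 2k₁.
bounded : ℕ → ℕ × ℕ → Bool
bounded g (d , c) = 5 * c + 8 * d + 3 ≤ᵇ 2 * g

admissible : ℕ → ℕ × ℕ → Bool
admissible g p = not (small g p) ∧ bounded g p

-- The admissible pairs, all of which have coordinates below g.
admissiblePairs : ℕ → List (ℕ × ℕ)
admissiblePairs g = filter (λ p → T? (admissible g p)) (cartesianProduct (upTo g) (upTo g))

pairCount : ℕ → ℕ
pairCount g = length (admissiblePairs g)

small-form : ∀ c d → 3 * c + 5 * d + 3 ≡ suc (suc (c + 2 * d) + suc (2 * c + 3 * d))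
small-form = solve-∀

bounded-form : ∀ c d → 5 * c + 8 * d + 3 ≡ suc (c + 2 * d) + (suc (2 * c + 3 * d) + suc (2 * c + 3 * d))
bounded-form = solve-∀

genus-form : ∀ k c d → k + suc (c + 2 * d) + (c + d) ≡ k + suc (2 * c + 3 * d)
genus-form = solve-∀

k2-form : ∀ c d → suc (c + 2 * d) ≡ suc (c + d) + d
k2-form = solve-∀

double-+ : ∀ k s → 2 * (k + s) ≡ (k + k) + (s + s)
double-+ = solve-∀

admissible-parts : ∀ g p → admissible g p ≡ true → (small g p ≡ false) × (bounded g p ≡ true)
admissible-parts g p eq with small g p | bounded g p
... | false | true = refl , refl
... | true | _ = contradiction eq (λ ())
... | false | false = contradiction eq (λ ())

pair⇒kunz : ∀ g → 4 ≤ g → ∀ d c → admissible g (d , c) ≡ true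
  → Kunz₂ g (g ∸ suc (2 * c + 3 * d)) (suc (c + 2 * d)) (c + d)
pair⇒kunz g 4≤g d c adm = record
  { k1≥1 = positive k1 (≤-trans (s≤s z≤n) k2≤2k1)
  ; k3≥1 = k3-positive c d (≤-trans 4≤g g≤k2+s)
  ; k1≤k2 = +-cancelʳ-≤ s k1 k2 (subst (_≤ k2 + s) (sym k1+s) g≤k2+s)
  ; k2≤2k1 = k2≤2k1
  ; k3<k2 = s≤s (+-monoʳ-≤ c (m≤m+n d (d + 0)))
  ; k2≤2k3+1 = s≤s (subst (c + 2 * d ≤_) (sym (twice c d)) (m≤m+n (c + 2 * d) c))
  ; genus = trans (genus-form k1 c d) k1+s }
  where
  s = suc (2 * c + 3 * d)
  k2 = suc (c + 2 * d)
  parts = admissible-parts g (d , c) adm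
  g≤k2+s : g ≤ k2 + s
  g≤k2+s = ≤-pred (subst (g <_) (small-form c d) (≤ᵇ-false⁻¹ (proj₁ parts)))
  k2+2s≤2g : k2 + (s + s) ≤ 2 * g
  k2+2s≤2g = subst (_≤ 2 * g) (bounded-form c d) (≤ᵇ-true⁻¹ (proj₂ parts))
  s≤g : s ≤ g
  s≤g = ≮⇒≥ (λ g<s → <⇒≱ (+-mono-< g<s g<s)
                 (≤-trans (m≤n+m (s + s) k2) (subst (k2 + (s + s) ≤_) (cong (g +_) (+-identityʳ g)) k2+2s≤2g)))
  k1 = g ∸ s
  k1+s : k1 + s ≡ g
  k1+s = m∸n+n≡m s≤g
  k2≤2k1 : k2 ≤ k1 + k1
  k2≤2k1 = +-cancelʳ-≤ (s + s) k2 (k1 + k1)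
             (subst (k2 + (s + s) ≤_) (trans (cong (2 *_) (sym k1+s)) (double-+ k1 s)) k2+2s≤2g)
  positive : ∀ x → 1 ≤ x + x → 1 ≤ x
  positive (suc x) _ = s≤s z≤n
  twice : ∀ c d → (c + d) + (c + d) ≡ (c + 2 * d) + c
  twice = solve-∀
  k3-positive : ∀ c d → 4 ≤ suc (c + 2 * d) + suc (2 * c + 3 * d) → 1 ≤ c + d
  k3-positive (suc c) d _ = s≤s z≤n
  k3-positive zero (suc d) _ = s≤s z≤n
  k3-positive zero zero (s≤s (s≤s ()))

kunz⇒pair : ∀ g k1 k2 k3 → Kunz₂ g k1 k2 k3 → Σ (ℕ × ℕ) λ p → p ∈ admissiblePairs g × kunzSet k1 k2 k3 ≗ pairSet g p
kunz⇒pair g k1 k2 k3 kz = (d , c) , member , λ n → cong (λ S → S n) (sym pairSet≡)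
  where
  open Kunz₂ kz
  d = k2 ∸ suc k3
  k3+d : suc k3 + d ≡ k2
  k3+d = m+[n∸m]≡n k3<k2
  d≤k3 : d ≤ k3
  d≤k3 = +-cancelˡ-≤ (suc k3) d k3 (subst (_≤ suc (k3 + k3)) (sym k3+d) k2≤2k3+1)
  c = k3 ∸ d
  c+d : c + d ≡ k3
  c+d = m∸n+n≡m d≤k3
  k2≡ : suc (c + 2 * d) ≡ k2
  k2≡ = trans (k2-form c d) (trans (cong (λ z → suc z + d) c+d) k3+d)
  s = suc (2 * c + 3 * d)
  k1+s : k1 + s ≡ g
  k1+s = trans (sym (genus-form k1 c d)) (trans (cong₂ (λ a b → k1 + a + b) k2≡ c+d) genus)
  pairSet≡ : pairSet g (d , c) ≡ kunzSet k1 k2 k3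
  pairSet≡ = trans (cong₂ (λ a b → kunzSet a b (c + d)) (trans (cong (_∸ s) (sym k1+s)) (m+n∸n≡m k1 s)) k2≡)
                   (cong (kunzSet k1 k2) c+d)
  not-small : small g (d , c) ≡ false
  not-small = ≤ᵇ-false (subst (g <_) (sym (small-form c d))
                (s≤s (subst₂ _≤_ k1+s (cong (_+ s) (sym k2≡)) (+-monoˡ-≤ s k1≤k2))))
  is-bounded : bounded g (d , c) ≡ true
  is-bounded = ≤ᵇ-true (subst₂ _≤_ (sym (bounded-form c d)) (trans (sym (double-+ k1 s)) (cong (2 *_) k1+s))
                 (+-monoˡ-≤ (s + s) (subst (_≤ k1 + k1) (sym k2≡) k2≤2k1)))
  k3<g : k3 < g
  k3<g = subst (k3 <_) genus (m<n+m k3 {k1 + k2} (≤-trans k1≥1 (m≤m+n k1 k2)))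
  member : (d , c) ∈ admissiblePairs g
  member = ∈-filter⁺ (λ p → T? (admissible g p))
    (∈-cartesianProduct⁺ (∈-upTo⁺ (≤-<-trans d≤k3 k3<g)) (∈-upTo⁺ (≤-<-trans (m∸n≤m k3 d) k3<g)))
    (Equivalence.from T-≡ (cong₂ (λ a b → not a ∧ b) not-small is-bounded))

-- Distinct pairs give distinct semigroups: k₃ = c + d and k₂ = c + 2d + 1 determine (d , c).
pairSet-injective : ∀ g p p' → pairSet g p ≗ pairSet g p' → p ≡ p'
pairSet-injective g (d , c) (d' , c') eq = cong₂ _,_ d≡ (+-cancelʳ-≡ d c c' (trans k3≡ (cong (c' +_) (sym d≡))))
  where
  k2≡ : suc (c + 2 * d) ≡ suc (c' + 2 * d')
  k2≡ = kunzSet-coord-injective 2 (s≤s (s≤s (s≤s z≤n))) eq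
  k3≡ : c + d ≡ c' + d'
  k3≡ = kunzSet-coord-injective 3 (s≤s (s≤s (s≤s (s≤s z≤n)))) eq
  d≡ : d ≡ d'
  d≡ = +-cancelˡ-≡ (c + d) d d' (suc-injective
         (trans (sym (k2-form c d)) (trans k2≡ (trans (k2-form c' d') (cong (λ z → suc z + d') (sym k3≡))))))

hasExactly-fromList : ∀ {A : Set} (P : Subset → Set) (ys : List A) (set : A → Subset) → Unique ys
  → (∀ a → a ∈ ys → P (set a)) → (∀ a b → set a ≗ set b → a ≡ b)
  → (∀ S → P S → Σ A λ a → a ∈ ys × S ≗ set a) → HasExactly (length ys) P
hasExactly-fromList {A} P ys set unique sound injective complete =
  (λ i → set (lookup ys i)) , (λ i → sound (lookup ys i) (∈-lookup i))
  , (λ i j i≢j eq → i≢j (lookup-injective unique i j (injective _ _ eq)))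
  , λ S PS → let (a , a∈ys , S≗a) = complete S PS
                 (i , ys[i]≡a) = index a∈ys
             in i , λ n → trans (S≗a n) (cong (λ z → set z n) (sym ys[i]≡a))
  where
  lookup-injective : ∀ {ys : List A} → Unique ys → ∀ i j → lookup ys i ≡ lookup ys j → i ≡ j
  lookup-injective (_ ∷ _) zero zero _ = refl
  lookup-injective (distinct ∷ _) zero (suc j) eq = contradiction eq (All.lookup distinct (∈-lookup j))
  lookup-injective (distinct ∷ _) (suc i) zero eq = contradiction (sym eq) (All.lookup distinct (∈-lookup i))
  lookup-injective (_ ∷ unique) (suc i) (suc j) eq = cong suc (lookup-injective unique i j eq)
  index : ∀ {a : A} {ys : List A} → a ∈ ys → Σ (Fin (length ys)) λ i → lookup ys i ≡ a
  index (here a≡) = zero , sym a≡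
  index (there a∈) = let (i , eq) = index a∈ in suc i , eq

pairCount-exact : ∀ g → 4 ≤ g → HasExactly (pairCount g) (N2Class g)
pairCount-exact g 4≤g = hasExactly-fromList (N2Class g) (admissiblePairs g) (pairSet g)
  (Unique.filter⁺ (λ p → T? (admissible g p)) {cartesianProduct (upTo g) (upTo g)} (Unique.cartesianProduct⁺ (Unique.upTo⁺ g) (Unique.upTo⁺ g)))
  sound (pairSet-injective g) complete
  where
  sound : ∀ p → p ∈ admissiblePairs g → N2Class g (pairSet g p)
  sound (d , c) p∈ = KunzSetInClass.inClass
    (pair⇒kunz g 4≤g d c (Equivalence.to T-≡ (proj₂ (∈-filter⁻ (λ p → T? (admissible g p)) {xs = cartesianProduct (upTo g) (upTo g)} p∈))))
  complete : ∀ S → N2Class g S → Σ (ℕ × ℕ) λ p → p ∈ admissiblePairs g × S ≗ pairSet g p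
  complete S inS =
    let (k1 , k2 , k3 , kz , S≗kunz) = inClass⇒kunz g S inS
        (p , p∈ , kunz≗pair) = kunz⇒pair g k1 k2 k3 kz
    in p , p∈ , λ n → trans (S≗kunz n) (kunz≗pair n)

-- Section 4.  Lattice points under a line and their second differences.

sumTo-support : ∀ f b b′ → (∀ d → b ≤ d → f d ≡ 0) → (∀ d → b′ ≤ d → f d ≡ 0) → sumTo f b ≡ sumTo f b′
sumTo-support f b b′ vanish vanish′ with ≤-total b b′
... | inj₁ b≤b′ = sym (sumTo-vanishingTail f b b′ vanish b≤b′)
... | inj₂ b′≤b = sumTo-vanishingTail f b′ b vanish′ b′≤b

≤-/ : ∀ k .{{_ : NonZero k}} c t → k * c ≤ t → c ≤ t / k
≤-/ k c t kc≤t = subst (_≤ t / k) (m*n/n≡m c k) (/-monoˡ-≤ k (subst (_≤ t) (*-comm k c) kc≤t))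

/-≤ : ∀ k .{{_ : NonZero k}} c t → c ≤ t / k → k * c ≤ t
/-≤ k c t c≤t/k = ≤-trans (*-monoʳ-≤ k c≤t/k) (subst (_≤ t) (*-comm (t / k) k) (m/n*n≤m t k))

-- lineCount k a t = #{c : k·c + a ≤ t} = ⌊(t − a)/k⌋ + 1 when a ≤ t.
lineCount : (k : ℕ) .{{_ : NonZero k}} → ℕ → ℕ → ℕ
lineCount k a t with a ≤? t
... | yes _ = suc ((t ∸ a) / k)
... | no _ = 0

lineCount-complete : ∀ k .{{_ : NonZero k}} a t c → k * c + a ≤ t → c < lineCount k a t
lineCount-complete k a t c le with a ≤? t
... | no a≰t = contradiction (≤-trans (m≤n+m a (k * c)) le) a≰t
... | yes _ = s≤s (≤-/ k c (t ∸ a) (subst (_≤ t ∸ a) (m+n∸n≡m (k * c) a) (∸-monoˡ-≤ a le)))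

lineCount-sound : ∀ k .{{_ : NonZero k}} a t c → c < lineCount k a t → k * c + a ≤ t
lineCount-sound k a t c lt with a ≤? t
... | no _ = contradiction lt (λ ())
... | yes a≤t = subst (k * c + a ≤_) (m∸n+n≡m a≤t) (+-monoˡ-≤ a (/-≤ k c (t ∸ a) (≤-pred lt)))

lineCount-empty : ∀ k .{{_ : NonZero k}} a t → t < a → lineCount k a t ≡ 0
lineCount-empty k a t t<a with a ≤? t
... | no _ = refl
... | yes a≤t = contradiction a≤t (<⇒≱ t<a)

lineCount-bound : ∀ k .{{_ : NonZero k}} a t K → t < K * k → lineCount k a t ≤ K
lineCount-bound k a t K t<Kk with a ≤? t
... | no _ = z≤n
... | yes _ = m<n*o⇒m/o<n (≤-<-trans (m∸n≤m t a) t<Kk)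

lineCount-shift : ∀ k .{{_ : NonZero k}} a t s → lineCount k (s + a) (s + t) ≡ lineCount k a t
lineCount-shift k a t s with a ≤? t | s + a ≤? s + t
... | yes _ | yes _ = cong (λ z → suc (z / k)) ([m+n]∸[m+o]≡n∸o s t a)
... | yes a≤t | no sa≰st = contradiction (+-monoʳ-≤ s a≤t) sa≰st
... | no a≰t | yes sa≤st = contradiction (+-cancelˡ-≤ s a t sa≤st) a≰t
... | no _ | no _ = refl

lineCount-add : ∀ k .{{_ : NonZero k}} a t j → a ≤ t → lineCount k a (j * k + t) ≡ j + lineCount k a t
lineCount-add k a t j a≤t with a ≤? t | a ≤? j * k + t
... | no a≰t | _ = contradiction a≤t a≰t
... | yes _ | no a≰jk+t = contradiction (≤-trans a≤t (m≤n+m t (j * k))) a≰jk+t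
... | yes _ | yes _ = begin
  suc ((j * k + t ∸ a) / k)    ≡⟨ cong (λ z → suc (z / k)) (trans (+-∸-assoc (j * k) a≤t) (+-comm (j * k) (t ∸ a))) ⟩
  suc ((t ∸ a + j * k) / k)    ≡⟨ cong suc (trans (divAdd (t ∸ a) j k) (+-comm _ j)) ⟩
  suc (j + (t ∸ a) / k)        ≡⟨ sym (+-suc j _) ⟩
  j + suc ((t ∸ a) / k)        ∎
  where open ≡-Reasoning

lineCount-indicator : ∀ k .{{_ : NonZero k}} a t K (p : ℕ → Bool) → t < K * k
  → (∀ c → k * c + a ≤ t → p c ≡ true) → (∀ c → p c ≡ true → k * c + a ≤ t)
  → sumTo (λ c → bit (p c)) K ≡ lineCount k a t
lineCount-indicator k a t K p t<Kk complete sound =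
  count-initialSegment p (lineCount k a t) K (lineCount-bound k a t K t<Kk)
    (λ c c<n → complete c (lineCount-sound k a t c c<n))
    (λ c n≤c → not-true (λ pc → <⇒≱ (lineCount-complete k a t c (sound c pc)) n≤c))
  where
  not-true : ∀ {b} → ¬ b ≡ true → b ≡ false
  not-true {false} _ = refl
  not-true {true} ¬true = contradiction refl ¬true

module Lattice (a b : ℕ) .{{_ : NonZero a}} .{{_ : NonZero b}} where

  row : ℕ → ℕ → ℕ
  row n d = lineCount b (a * d) n

  -- T(n) = #{(d , c) : a·d + b·c ≤ n}; rows d > n are empty.
  latticeCount : ℕ → ℕ
  latticeCount n = sumTo (row n) (suc n)

  latticeCount-rows : ∀ n K → n < a * K → sumTo (row n) K ≡ latticeCount n
  latticeCount-rows n K n<aK = sumTo-support (row n) K (suc n)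
    (λ d K≤d → lineCount-empty b (a * d) n (<-≤-trans n<aK (*-monoʳ-≤ a K≤d)))
    (λ d n<d → lineCount-empty b (a * d) n (<-≤-trans n<d (m≤n*m d a)))

  -- The first b rows of T(ab + n); the other rows are those of T(n), moved up by ab.
  boundary : ℕ → ℕ
  boundary n = sumTo (row (a * b + n)) b

  latticeCount-step : ∀ n → latticeCount (a * b + n) ≡ boundary n + latticeCount n
  latticeCount-step n = begin
    latticeCount (a * b + n)                           ≡⟨ sym (latticeCount-rows (a * b + n) K (<-≤-trans (n<K) (m≤n*m K a))) ⟩
    sumTo (row (a * b + n)) (b + suc (a * b + n))      ≡⟨ sumTo-split (row (a * b + n)) b _ ⟩
    boundary n + sumTo (λ x → row (a * b + n) (b + x)) (suc (a * b + n))
                                                       ≡⟨ cong (boundary n +_) (sumTo-cong _ _ (suc (a * b + n)) (λ x _ → moved x)) ⟩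
    boundary n + sumTo (row n) (suc (a * b + n))       ≡⟨ cong (boundary n +_) (latticeCount-rows n _ (<-≤-trans (s≤s (m≤n+m n (a * b))) (m≤n*m _ a))) ⟩
    boundary n + latticeCount n                        ∎
    where
    open ≡-Reasoning
    K = b + suc (a * b + n)
    n<K : a * b + n < K
    n<K = ≤-trans (n<1+n _) (m≤n+m _ b)
    moved : ∀ x → row (a * b + n) (b + x) ≡ row n x
    moved x = trans (cong (λ z → lineCount b z (a * b + n)) (*-distribˡ-+ a b x)) (lineCount-shift b (a * x) n (a * b))

  boundary-shift : ∀ j n → boundary (j * b + n) ≡ b * j + boundary n
  boundary-shift j n = sumTo-offset _ _ j b more
    where
    swap : a * b + (j * b + n) ≡ j * b + (a * b + n)
    swap = trans (sym (+-assoc (a * b) (j * b) n)) (trans (cong (_+ n) (+-comm (a * b) (j * b))) (+-assoc (j * b) (a * b) n))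
    more : ∀ d → d < b → row (a * b + (j * b + n)) d ≡ j + row (a * b + n) d
    more d d<b = trans (cong (lineCount b (a * d)) swap)
      (lineCount-add b (a * d) (a * b + n) j (≤-trans (*-monoʳ-≤ a (<⇒≤ d<b)) (m≤m+n (a * b) n)))

  -- T(r·ab + n) − T(n), as r consecutive boundaries.
  window : ℕ → ℕ → ℕ
  window r n = sumTo (λ i → boundary (i * (a * b) + n)) r

  latticeCount-window : ∀ r n → latticeCount (r * (a * b) + n) ≡ window r n + latticeCount n
  latticeCount-window zero n = refl
  latticeCount-window (suc r) n = begin
    latticeCount ((a * b + r * (a * b)) + n)           ≡⟨ cong latticeCount (regroup (a * b) (r * (a * b)) n) ⟩
    latticeCount (r * (a * b) + (a * b + n))           ≡⟨ latticeCount-window r (a * b + n) ⟩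
    window r (a * b + n) + latticeCount (a * b + n)    ≡⟨ cong (window r (a * b + n) +_) (latticeCount-step n) ⟩
    window r (a * b + n) + (boundary n + latticeCount n)
                                                       ≡⟨ interchange (window r (a * b + n)) (boundary n) (latticeCount n) ⟩
    boundary n + window r (a * b + n) + latticeCount n ≡⟨ cong (λ w → boundary n + w + latticeCount n) (sumTo-cong _ _ r (λ i _ → cong boundary (regroup′ i))) ⟩
    window (suc r) n + latticeCount n                  ∎
    where
    open ≡-Reasoning
    regroup : ∀ x y n → x + y + n ≡ y + (x + n)
    regroup = solve-∀
    interchange : ∀ w x t → w + (x + t) ≡ x + w + t
    interchange = solve-∀
    regroup′ : ∀ i → i * (a * b) + (a * b + n) ≡ (a * b + i * (a * b)) + n
    regroup′ i = sym (regroup (a * b) (i * (a * b)) n)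

  window-shift : ∀ r n → window r (r * (a * b) + n) ≡ r * (r * (a * b)) + window r n
  window-shift r n = begin
    window r (r * (a * b) + n)              ≡⟨ sumTo-offset _ _ (b * (r * a)) r more ⟩
    r * (b * (r * a)) + window r n          ≡⟨ cong (_+ window r n) (reassoc r a b) ⟩
    r * (r * (a * b)) + window r n          ∎
    where
    open ≡-Reasoning
    reassoc : ∀ r a b → r * (b * (r * a)) ≡ r * (r * (a * b))
    reassoc = solve-∀
    regroup : ∀ i r a b n → i * (a * b) + (r * (a * b) + n) ≡ r * a * b + (i * (a * b) + n)
    regroup = solve-∀
    more : ∀ i → i < r → boundary (i * (a * b) + (r * (a * b) + n)) ≡ b * (r * a) + boundary (i * (a * b) + n)
    more i _ = trans (cong boundary (regroup i r a b n)) (boundary-shift (r * a) (i * (a * b) + n))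

  latticeCount-secondDifference : ∀ r P → P ≡ r * (a * b) → ∀ n →
    latticeCount (P + (P + n)) + latticeCount n ≡ latticeCount (P + n) + latticeCount (P + n) + r * P
  latticeCount-secondDifference r P refl n = begin
    latticeCount (P + (P + n)) + latticeCount n                  ≡⟨ cong (_+ latticeCount n) (latticeCount-window r (P + n)) ⟩
    window r (P + n) + latticeCount (P + n) + latticeCount n     ≡⟨ cong (λ w → w + latticeCount (P + n) + latticeCount n) (window-shift r n) ⟩
    r * P + window r n + latticeCount (P + n) + latticeCount n   ≡⟨ regroup (r * P) (window r n) (latticeCount (P + n)) (latticeCount n) ⟩
    latticeCount (P + n) + (window r n + latticeCount n) + r * P ≡⟨ cong (λ t → latticeCount (P + n) + t + r * P) (sym (latticeCount-window r n)) ⟩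
    latticeCount (P + n) + latticeCount (P + n) + r * P          ∎
    where
    open ≡-Reasoning
    regroup : ∀ x w y t → x + w + y + t ≡ y + (w + t) + x
    regroup = solve-∀

-- Section 5.  The number of admissible pairs.

open Lattice using (latticeCount; latticeCount-rows; latticeCount-secondDifference)

small⇒bounded : ∀ g d c → 3 * c + 5 * d + 3 ≤ g → 5 * c + 8 * d + 3 ≤ 2 * g
small⇒bounded g d c le = ≤-trans (≤-trans (m≤m+n _ (c + 2 * d + 3)) (≤-reflexive (doubling c d))) (+-mono-≤ le (≤-trans le (≤-reflexive (sym (+-identityʳ g)))))
  where
  doubling : ∀ c d → 5 * c + 8 * d + 3 + (c + 2 * d + 3) ≡ (3 * c + 5 * d + 3) + (3 * c + 5 * d + 3)
  doubling = solve-∀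

-- Since small pairs are bounded, "admissible or small" means "bounded".
bit-admissible : ∀ g p → bit (admissible g p) + bit (small g p) ≡ bit (bounded g p)
bit-admissible g (d , c) with small g (d , c) in isSmall | bounded g (d , c) in isBounded
... | true | true = refl
... | false | true = refl
... | false | false = refl
... | true | false = contradiction (≤ᵇ-true (small⇒bounded g d c (≤ᵇ-true⁻¹ isSmall))) (λ eq → case (trans (sym eq) isBounded))
  where
  case : true ≢ false
  case ()

row-small : ∀ h d → sumTo (λ c → bit (small (3 + h) (d , c))) (3 + h) ≡ lineCount 3 (5 * d) h
row-small h d = lineCount-indicator 3 (5 * d) h (3 + h) (λ c → small (3 + h) (d , c))
  (≤-trans (m≤n+m (suc h) 2) (m≤m*n (3 + h) 3))
  (λ c le → ≤ᵇ-true (subst (3 * c + 5 * d + 3 ≤_) (+-comm h 3) (+-monoˡ-≤ 3 le)))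
  (λ c isSmall → +-cancelʳ-≤ 3 _ _ (subst (3 * c + 5 * d + 3 ≤_) (+-comm 3 h) (≤ᵇ-true⁻¹ isSmall)))

row-bounded : ∀ h d → sumTo (λ c → bit (bounded (3 + h) (d , c))) (3 + h) ≡ lineCount 5 (8 * d) (3 + (h + h))
row-bounded h d = lineCount-indicator 5 (8 * d) (3 + (h + h)) (3 + h) (λ c → bounded (3 + h) (d , c))
  (subst (3 + (h + h) <_) (five h) (m≤m+n (suc (3 + (h + h))) (11 + 3 * h)))
  (λ c le → ≤ᵇ-true (subst (5 * c + 8 * d + 3 ≤_) (sym (double h)) (+-monoˡ-≤ 3 le)))
  (λ c isBounded → +-cancelʳ-≤ 3 _ _ (subst (5 * c + 8 * d + 3 ≤_) (double h) (≤ᵇ-true⁻¹ isBounded)))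
  where
  five : ∀ h → suc (3 + (h + h)) + (11 + 3 * h) ≡ (3 + h) * 5
  five = solve-∀
  double : ∀ h → 2 * (3 + h) ≡ 3 + (h + h) + 3
  double = solve-∀

-- C(3 + h) + T_{5,3}(h) = T_{8,5}(3 + 2h): summing row by row, admissible and
-- small pairs together are the bounded ones.
pairCount-lattice : ∀ h → pairCount (3 + h) + latticeCount 5 3 h ≡ latticeCount 8 5 (3 + (h + h))
pairCount-lattice h = begin
  pairCount g + latticeCount 5 3 h
    ≡⟨ cong₂ _+_ (length-filter-square (admissible g) g) (sym (latticeCount-rows 5 3 h g (≤-trans (m≤n+m (suc h) 2) (m≤n*m g 5)))) ⟩
  sumTo (λ d → sumTo (λ c → bit (admissible g (d , c))) g) g + sumTo (λ d → lineCount 3 (5 * d) h) g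
    ≡⟨ sym (sumTo-+ (λ d → sumTo (λ c → bit (admissible g (d , c))) g) (λ d → lineCount 3 (5 * d) h) g) ⟩
  sumTo (λ d → sumTo (λ c → bit (admissible g (d , c))) g + lineCount 3 (5 * d) h) g
    ≡⟨ sumTo-cong _ _ g (λ d _ → byRow d) ⟩
  sumTo (λ d → lineCount 5 (8 * d) n) g
    ≡⟨ latticeCount-rows 8 5 n g (subst (n <_) (eight h) (m≤m+n (suc n) (20 + 6 * h))) ⟩
  latticeCount 8 5 n ∎
  where
  open ≡-Reasoning
  g = 3 + h
  n = 3 + (h + h)
  eight : ∀ h → suc (3 + (h + h)) + (20 + 6 * h) ≡ 8 * (3 + h)
  eight = solve-∀
  byRow : ∀ d → sumTo (λ c → bit (admissible g (d , c))) g + lineCount 3 (5 * d) h ≡ lineCount 5 (8 * d) n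
  byRow d = begin
    sumTo (λ c → bit (admissible g (d , c))) g + lineCount 3 (5 * d) h
      ≡⟨ cong (sumTo (λ c → bit (admissible g (d , c))) g +_) (sym (row-small h d)) ⟩
    sumTo (λ c → bit (admissible g (d , c))) g + sumTo (λ c → bit (small g (d , c))) g
      ≡⟨ sym (sumTo-+ (λ c → bit (admissible g (d , c))) (λ c → bit (small g (d , c))) g) ⟩
    sumTo (λ c → bit (admissible g (d , c)) + bit (small g (d , c))) g
      ≡⟨ sumTo-cong _ _ g (λ c _ → bit-admissible g (d , c)) ⟩
    sumTo (λ c → bit (bounded g (d , c))) g
      ≡⟨ row-bounded h d ⟩
    lineCount 5 (8 * d) n ∎

-- Hence C(g + 120) + C(g) = 2C(g + 60) + 120, from the second differences of
-- T_{8,5} (period 120 = 3·40) and T_{5,3} (period 60 = 4·15).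
pairCount-secondDifference : ∀ h → pairCount (3 + (60 + (60 + h))) + pairCount (3 + h)
                                   ≡ pairCount (3 + (60 + h)) + pairCount (3 + (60 + h)) + 120
pairCount-secondDifference h = +-cancelʳ-≡ (q + q + 240) _ _ (begin
  (A + B) + (q + q + 240)            ≡⟨ cong ((A + B) +_) (sym (latticeCount-secondDifference 5 3 4 60 refl h)) ⟩
  (A + B) + (r + p)                  ≡⟨ interchange A B r p ⟩
  (A + r) + (B + p)                  ≡⟨ cong₂ _+_ (trans (pairCount-lattice (60 + (60 + h))) (cong Φ (doubled₂ h))) (pairCount-lattice h) ⟩
  Φ (120 + (120 + n)) + Φ n          ≡⟨ latticeCount-secondDifference 8 5 3 120 refl n ⟩
  Φ (120 + n) + Φ (120 + n) + 360    ≡⟨ cong (λ z → z + z + 360) (sym (trans (pairCount-lattice (60 + h)) (cong Φ (doubled₁ h)))) ⟩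
  (M + q) + (M + q) + 360            ≡⟨ regroup M q ⟩
  (M + M + 120) + (q + q + 240)      ∎)
  where
  open ≡-Reasoning
  Φ = latticeCount 8 5
  n = 3 + (h + h)
  A = pairCount (3 + (60 + (60 + h)))
  B = pairCount (3 + h)
  M = pairCount (3 + (60 + h))
  p = latticeCount 5 3 h
  q = latticeCount 5 3 (60 + h)
  r = latticeCount 5 3 (60 + (60 + h))
  doubled₂ : ∀ h → 3 + ((60 + (60 + h)) + (60 + (60 + h))) ≡ 120 + (120 + (3 + (h + h)))
  doubled₂ = solve-∀
  doubled₁ : ∀ h → 3 + ((60 + h) + (60 + h)) ≡ 120 + (3 + (h + h))
  doubled₁ = solve-∀
  interchange : ∀ a b c d → (a + b) + (c + d) ≡ (a + c) + (b + d)
  interchange = solve-∀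
  regroup : ∀ m q → (m + q) + (m + q) + 360 ≡ (m + m + 120) + (q + q + 240)
  regroup = solve-∀

-- Section 6.  The closed form, and the induction matching it with the count.

-- ℕq n is already in normal form n/1, so ℕq is additive.
ℕq-mkℚ : ∀ n → ℕq n ≡ mkℚ (+ℤ n) 0 (coprime-sym (1-coprimeTo n))
ℕq-mkℚ n = normalize-coprime (coprime-sym (1-coprimeTo n))

ℕq-+ : ∀ m n → ℕq (m + n) ≡ ℕq m +q ℕq n
ℕq-+ m n rewrite ℕq-mkℚ m | ℕq-mkℚ n | *-identityʳ m | *-identityʳ n | +◃n≡+n m | +◃n≡+n n = refl

floor-shift : ∀ x y k d .{{_ : NonZero d}} → x ≡ y + k * d → ℕq (x / d) ≡ ℕq (y / d) +q ℕq k
floor-shift x y k d refl = trans (cong ℕq (divAdd y k d)) (ℕq-+ (y / d) k)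

closedForm : ℚ → ℚ → ℚ → ℚ → ℚ → ℚ → ℚ → ℚ → ℚ → ℚ
closedForm a b c d e f h k G = (- (a *q a)) +q (b *q b) - (fr 3 2 *q (c *q c)) +q (d *q d) - (e *q e)
     +q (f *q f) +q (h *q h) - a +q ((G - fr 3 2) *q c) +q ((ℕq 1 - G) *q d)
     +q (b *q (ℕq 1 - k)) +q ((fr 1 2 *q G - fr 1 4) *q k) +q (d *q e)
     - (k *q f) +q ((a - G +q ℕq 1) *q h) +q (fr 1 8 *q (G *q G)) - (fr 1 8 *q G)

-- Replacing g by g + 60 raises the floors ⌊g/5⌋, ⌊g/4⌋, ⌊g/3⌋, ⌊2g/5⌋, ⌊(g+2)/5⌋,
-- ⌊(g+2)/4⌋, ⌊(2g+1)/5⌋, ⌊g/2⌋, g by 12, 15, 20, 24, 12, 15, 24, 30, 60, so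
-- E8 (j·60 + g) is closedForm at the shifted values.
E8-shift : ∀ j g → E8 (j * 60 + g) ≡
  closedForm (ℕq (g / 5) +q ℕq (j * 12)) (ℕq (g / 4) +q ℕq (j * 15)) (ℕq (g / 3) +q ℕq (j * 20))
             (ℕq ((2 * g) / 5) +q ℕq (j * 24)) (ℕq ((g + 2) / 5) +q ℕq (j * 12))
             (ℕq ((g + 2) / 4) +q ℕq (j * 15)) (ℕq ((2 * g + 1) / 5) +q ℕq (j * 24))
             (ℕq (g / 2) +q ℕq (j * 30)) (ℕq g +q ℕq (j * 60))
E8-shift j g = cong₉ closedForm
  (floor-shift _ g (j * 12) 5 (sixty g 12 5 refl))
  (floor-shift _ g (j * 15) 4 (sixty g 15 4 refl))
  (floor-shift _ g (j * 20) 3 (sixty g 20 3 refl))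
  (floor-shift _ (2 * g) (j * 24) 5 (twice j g))
  (floor-shift _ (g + 2) (j * 12) 5 (trans (+-assoc (j * 60) g 2) (sixty (g + 2) 12 5 refl)))
  (floor-shift _ (g + 2) (j * 15) 4 (trans (+-assoc (j * 60) g 2) (sixty (g + 2) 15 4 refl)))
  (floor-shift _ (2 * g + 1) (j * 24) 5 (twice+1 j g))
  (floor-shift _ g (j * 30) 2 (sixty g 30 2 refl))
  (trans (cong ℕq (+-comm (j * 60) g)) (ℕq-+ g (j * 60)))
  where
  cong₉ : ∀ (F : ℚ → ℚ → ℚ → ℚ → ℚ → ℚ → ℚ → ℚ → ℚ → ℚ) {a a′ b b′ c c′ d d′ e e′ f f′ h h′ k k′ G G′}
    → a ≡ a′ → b ≡ b′ → c ≡ c′ → d ≡ d′ → e ≡ e′ → f ≡ f′ → h ≡ h′ → k ≡ k′ → G ≡ G′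
    → F a b c d e f h k G ≡ F a′ b′ c′ d′ e′ f′ h′ k′ G′
  cong₉ F refl refl refl refl refl refl refl refl refl = refl
  sixty : ∀ y q m → q * m ≡ 60 → j * 60 + y ≡ y + j * q * m
  sixty y q m qm = trans (+-comm (j * 60) y) (cong (y +_) (trans (cong (j *_) (sym qm)) (sym (*-assoc j q m))))
  twice : ∀ j g → 2 * (j * 60 + g) ≡ 2 * g + j * 24 * 5
  twice = solve-∀
  twice+1 : ∀ j g → 2 * (j * 60 + g) + 1 ≡ 2 * g + 1 + j * 24 * 5
  twice+1 = solve-∀

closedForm-secondDifference : ∀ a b c d e f h k G →
  closedForm (a +q ℕq 24) (b +q ℕq 30) (c +q ℕq 40) (d +q ℕq 48) (e +q ℕq 24) (f +q ℕq 30) (h +q ℕq 48) (k +q ℕq 60) (G +q ℕq 120)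
  +q closedForm a b c d e f h k G
  ≡ (closedForm (a +q ℕq 12) (b +q ℕq 15) (c +q ℕq 20) (d +q ℕq 24) (e +q ℕq 12) (f +q ℕq 15) (h +q ℕq 24) (k +q ℕq 30) (G +q ℕq 60)
  +q closedForm (a +q ℕq 12) (b +q ℕq 15) (c +q ℕq 20) (d +q ℕq 24) (e +q ℕq 12) (f +q ℕq 15) (h +q ℕq 24) (k +q ℕq 30) (G +q ℕq 60))
  +q ℕq 120
closedForm-secondDifference = solve 9 (λ a b c d e f h k G →
     let F : _ → _ → _ → _ → _ → _ → _ → _ → _ → _
         F a b c d e f h k G = (:- (a :* a)) :+ (b :* b) :- (con (fr 3 2) :* (c :* c)) :+ (d :* d) :- (e :* e)
           :+ (f :* f) :+ (h :* h) :- a :+ ((G :- con (fr 3 2)) :* c) :+ ((con (ℕq 1) :- G) :* d)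
           :+ (b :* (con (ℕq 1) :- k)) :+ ((con (fr 1 2) :* G :- con (fr 1 4)) :* k) :+ (d :* e)
           :- (k :* f) :+ ((a :- G :+ con (ℕq 1)) :* h) :+ (con (fr 1 8) :* (G :* G)) :- (con (fr 1 8) :* G)
         _⊕_ : _ → _ → _
         x ⊕ n = x :+ con (ℕq n)
     in F (a ⊕ 24) (b ⊕ 30) (c ⊕ 40) (d ⊕ 48) (e ⊕ 24) (f ⊕ 30) (h ⊕ 48) (k ⊕ 60) (G ⊕ 120) :+ F a b c d e f h k G
        := (F (a ⊕ 12) (b ⊕ 15) (c ⊕ 20) (d ⊕ 24) (e ⊕ 12) (f ⊕ 15) (h ⊕ 24) (k ⊕ 30) (G ⊕ 60)
            :+ F (a ⊕ 12) (b ⊕ 15) (c ⊕ 20) (d ⊕ 24) (e ⊕ 12) (f ⊕ 15) (h ⊕ 24) (k ⊕ 30) (G ⊕ 60)) :+ con (ℕq 120)) refl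
  where open ℚSolver.+-*-Solver

-- E8(g + 120) + E8(g) = 2 E8(g + 60) + 120.  The shifts are applied through
-- explicit equations on ℕ, so that E8 is only ever unfolded at a variable.
E8-secondDifference : ∀ g → E8 (60 + (60 + g)) +q E8 g ≡ (E8 (60 + g) +q E8 (60 + g)) +q ℕq 120
E8-secondDifference g = begin
  E8 (60 + (60 + g)) +q E8 g
    ≡⟨ cong (_+q E8 g) (trans (cong E8 (twice g)) (E8-shift 2 g)) ⟩
  _ ≡⟨ closedForm-secondDifference (ℕq (g / 5)) (ℕq (g / 4)) (ℕq (g / 3)) (ℕq ((2 * g) / 5)) (ℕq ((g + 2) / 5))
                                   (ℕq ((g + 2) / 4)) (ℕq ((2 * g + 1) / 5)) (ℕq (g / 2)) (ℕq g) ⟩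
  _ ≡⟨ sym (cong (λ z → (z +q z) +q ℕq 120) (trans (cong E8 (once g)) (E8-shift 1 g))) ⟩
  (E8 (60 + g) +q E8 (60 + g)) +q ℕq 120 ∎
  where
  open ≡-Reasoning
  twice : ∀ g → 60 + (60 + g) ≡ 2 * 60 + g
  twice = solve-∀
  once : ∀ g → 60 + g ≡ 1 * 60 + g
  once = solve-∀

recurrence-step : ∀ (u v : ℕ → ℚ) p K
  → (∀ h → u (p + (p + h)) +q u h ≡ (u (p + h) +q u (p + h)) +q K)
  → (∀ h → v (p + (p + h)) +q v h ≡ (v (p + h) +q v (p + h)) +q K)
  → ∀ h → u h ≡ v h → u (p + h) ≡ v (p + h) → u (p + (p + h)) ≡ v (p + (p + h))
recurrence-step u v p K u-rec v-rec h u≡v u≡v′ = +q-cancelʳ (u h) _ _ (begin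
  u (p + (p + h)) +q u h                ≡⟨ u-rec h ⟩
  (u (p + h) +q u (p + h)) +q K          ≡⟨ cong (λ z → (z +q z) +q K) u≡v′ ⟩
  (v (p + h) +q v (p + h)) +q K          ≡⟨ sym (v-rec h) ⟩
  v (p + (p + h)) +q v h                ≡⟨ cong (v (p + (p + h)) +q_) (sym u≡v) ⟩
  v (p + (p + h)) +q u h                ∎)
  where open ≡-Reasoning

twoStep-induction : ∀ (P : ℕ → Set) p s .{{_ : NonZero p}}
  → (∀ h → s ≤ h → h < p + p + s → P h) → (∀ h → P h → P (p + h) → P (p + (p + h)))
  → ∀ h → s ≤ h → P h
twoStep-induction P p s base step = <-rec (λ h → s ≤ h → P h) induct
  where
  induct : ∀ h → (∀ {y} → y < h → s ≤ y → P y) → s ≤ h → P h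
  induct h IH s≤h with h <? p + p + s
  ... | yes h<2p+s = base h s≤h h<2p+s
  ... | no h≮2p+s = subst P h≡ (step o (IH o<h s≤o) (IH p+o<h (≤-trans s≤o (m≤n+m o p))))
    where
    o = h ∸ (p + p)
    2p≤h : p + p ≤ h
    2p≤h = ≤-trans (m≤m+n (p + p) s) (≮⇒≥ h≮2p+s)
    h≡ : p + (p + o) ≡ h
    h≡ = trans (sym (+-assoc p p o)) (m+[n∸m]≡n 2p≤h)
    s≤o : s ≤ o
    s≤o = +-cancelˡ-≤ (p + p) s o (subst (p + p + s ≤_) (sym (m+[n∸m]≡n 2p≤h)) (≮⇒≥ h≮2p+s))
    p+o<h : p + o < h
    p+o<h = subst (p + o <_) h≡ (m<n+m (p + o) (>-nonZero⁻¹ p))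
    o<h : o < h
    o<h = <-trans (m<n+m o (>-nonZero⁻¹ p)) p+o<h

-- The pair count in terms of the lattice counts, which are fast to evaluate.
pairCount-viaLattice : ∀ h → pairCount (3 + h) ≡ latticeCount 8 5 (3 + (h + h)) ∸ latticeCount 5 3 h
pairCount-viaLattice h = sym (trans (cong (_∸ latticeCount 5 3 h) (sym (pairCount-lattice h)))
                                    (m+n∸n≡m (pairCount (3 + h)) (latticeCount 5 3 h)))

windowEquation : ℕ → Set
windowEquation h = ℕq (latticeCount 8 5 (3 + (h + h)) ∸ latticeCount 5 3 h) ≡ E8 (3 + h)

-- The closed form is correct for 8 ≤ g < 128, by evaluation of the decision procedure.
initialWindow : All (λ i → T (isYes (ℕq (latticeCount 8 5 (3 + ((5 + i) + (5 + i))) ∸ latticeCount 5 3 (5 + i)) ≟q E8 (3 + (5 + i))))) (upTo 120)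
initialWindow = all⁺ (λ i → isYes (ℕq (latticeCount 8 5 (3 + ((5 + i) + (5 + i))) ∸ latticeCount 5 3 (5 + i)) ≟q E8 (3 + (5 + i)))) (upTo 120) tt

≟q-sound : ∀ x y → T (isYes (x ≟q y)) → x ≡ y
≟q-sound x y = toWitness

pairCount-E8 : ∀ h → 5 ≤ h → ℕq (pairCount (3 + h)) ≡ E8 (3 + h)
pairCount-E8 = twoStep-induction (λ h → ℕq (pairCount (3 + h)) ≡ E8 (3 + h)) 60 5 base
  (recurrence-step (λ h → ℕq (pairCount (3 + h))) (λ h → E8 (3 + h)) 60 (ℕq 120) count-recurrence E8-recurrence)
  where
  window : ∀ i → i < 120 → windowEquation (5 + i)
  window i i<120 = ≟q-sound (ℕq (latticeCount 8 5 (3 + ((5 + i) + (5 + i))) ∸ latticeCount 5 3 (5 + i))) (E8 (3 + (5 + i)))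
                            (All.lookup initialWindow (∈-upTo⁺ i<120))
  base : ∀ h → 5 ≤ h → h < 125 → ℕq (pairCount (3 + h)) ≡ E8 (3 + h)
  base h 5≤h h<125 = trans (cong ℕq (pairCount-viaLattice h))
    (subst windowEquation (m+[n∸m]≡n 5≤h) (window (h ∸ 5) (∸-monoˡ-< h<125 5≤h)))
  count-recurrence : ∀ h → ℕq (pairCount (3 + (60 + (60 + h)))) +q ℕq (pairCount (3 + h))
                         ≡ (ℕq (pairCount (3 + (60 + h))) +q ℕq (pairCount (3 + (60 + h)))) +q ℕq 120
  count-recurrence h = begin
    ℕq (pairCount (3 + (60 + (60 + h)))) +q ℕq (pairCount (3 + h))
      ≡⟨ sym (ℕq-+ (pairCount (3 + (60 + (60 + h)))) (pairCount (3 + h))) ⟩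
    ℕq (pairCount (3 + (60 + (60 + h))) + pairCount (3 + h))
      ≡⟨ cong ℕq (pairCount-secondDifference h) ⟩
    ℕq (pairCount (3 + (60 + h)) + pairCount (3 + (60 + h)) + 120)
      ≡⟨ ℕq-+ (pairCount (3 + (60 + h)) + pairCount (3 + (60 + h))) 120 ⟩
    ℕq (pairCount (3 + (60 + h)) + pairCount (3 + (60 + h))) +q ℕq 120
      ≡⟨ cong (_+q ℕq 120) (ℕq-+ (pairCount (3 + (60 + h))) (pairCount (3 + (60 + h)))) ⟩
    (ℕq (pairCount (3 + (60 + h))) +q ℕq (pairCount (3 + (60 + h)))) +q ℕq 120 ∎
    where open ≡-Reasoning
  E8-recurrence : ∀ h → E8 (3 + (60 + (60 + h))) +q E8 (3 + h) ≡ (E8 (3 + (60 + h)) +q E8 (3 + (60 + h))) +q ℕq 120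
  E8-recurrence h = trans (cong (λ x → E8 x +q E8 (3 + h)) (shift₂ h))
    (trans (E8-secondDifference (3 + h)) (cong (λ x → (E8 x +q E8 x) +q ℕq 120) (sym (shift₁ h))))
    where
    shift₂ : ∀ h → 3 + (60 + (60 + h)) ≡ 60 + (60 + (3 + h))
    shift₂ = solve-∀
    shift₁ : ∀ h → 3 + (60 + h) ≡ 60 + (3 + h)
    shift₁ = solve-∀

pairCount-formula : ∀ g → 4 ≤ g → ℕq (pairCount g) ≡ N2value g
pairCount-formula 0 ()
pairCount-formula 1 (s≤s ())
pairCount-formula 2 (s≤s (s≤s ()))
pairCount-formula 3 (s≤s (s≤s (s≤s ())))
pairCount-formula 4 _ = refl
pairCount-formula 5 _ = refl
pairCount-formula 6 _ = refl
pairCount-formula 7 _ = refl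
pairCount-formula (suc (suc (suc (suc (suc (suc (suc (suc x)))))))) _ = pairCount-E8 (5 + x) (m≤m+n 5 x)

proposition3p3 : (g : ℕ) → 4 ≤ g →
    ∃ λ n → HasExactly n (N2Class g) × (ℕq n ≡ N2value g)
proposition3p3 g 4≤g = pairCount g , pairCount-exact g 4≤g , pairCount-formula g 4≤g
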